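{- Let $q=2^r$. Then (a) $T_{0}K=1+\frac{1}{2}(-1)^{r}q$; (b) $T_{1}K=\frac{1}{2}(-1)^{r+1}q$.
   Context: $q=2^r$ with $r\ge 1$; $\mathbb{F}_q$ is the field with $q$ elements; $tr(x)=x+x^2+\cdots+x^{2^{r-1}}$ is the absolute trace $\mathbb{F}_q\to\mathbb{F}_2$ and $\lambda(x)=(-1)^{tr(x)}$. For $a\in\mathbb{F}_q^*$, $K(\lambda;a)=\sum_{\alpha\in\mathbb{F}_q^*}\lambda(\alpha+a\alpha^{ -1})$. $T_0K=\sum_{a\in\mathbb{F}_q^*,\ tr(a)=0}K(\lambda;a)$ and $T_1K=\sum_{a\in\mathbb{F}_q^*,\ tr(a)=1}K(\lambda;a)$. -}

module Defs where

open import Data.Nat using (ℕ; zero; suc)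
import Data.Nat as ℕ
open import Data.Integer using (ℤ; +_) renaming (_+_ to _+ℤ_; -_ to negℤ)
open import Data.List using (List; []; _∷_; foldr; map; filter; length)
open import Data.List.Relation.Unary.Unique.Propositional using (Unique)
open import Data.List.Membership.Propositional using (_∈_)
open import Data.Bool using (if_then_else_)
open import Relation.Nullary using (¬_; does; ¬?)
open import Relation.Binary.PropositionalEquality using (_≡_)
open import Relation.Binary.Definitions using (DecidableEquality)
open import Algebra.Core using (Op₁; Op₂)
open import Algebra.Structures using (IsCommutativeRing)

record FiniteField : Set₁ where
  infixl 6 _+_
  infixl 7 _*_
  field
    Carrier : Set
    _+_ _*_ : Op₂ Carrier
    -_      : Op₁ Carrier
    0# 1#   : Carrier
    _⁻¹     : Op₁ Carrier
    isCommutativeRing : IsCommutativeRing _≡_ _+_ _*_ -_ 0# 1#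
    0≢1     : ¬ (0# ≡ 1#)
    ⁻¹-inverse : ∀ x → ¬ (x ≡ 0#) → x * (x ⁻¹) ≡ 1#
    _≟_     : DecidableEquality Carrier
    elements : List Carrier
    elements-unique   : Unique elements
    elements-complete : ∀ x → x ∈ elements

sumℤ : List ℤ → ℤ
sumℤ = foldr _+ℤ_ (+ 0)

module _ (F : FiniteField) where
  open FiniteField F

  order : ℕ
  order = length elements

  pow : Carrier → ℕ → Carrier
  pow x zero    = 1#
  pow x (suc n) = x * pow x n

  traceSum : ℕ → Carrier → Carrier
  traceSum zero    x = 0#
  traceSum (suc n) x = traceSum n x + pow x (2 ℕ.^ n)

  -- absolute trace tr(x) = x + x^2 + ... + x^(2^(r-1)) for q = 2^r
  tr : ℕ → Carrier → Carrier
  tr r = traceSum r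

  -- λ(x) = (-1)^{tr(x)}  (tr(x) ∈ {0,1} ⊆ F; value +1 iff tr(x) = 0)
  lam : ℕ → Carrier → ℤ
  lam r x = if does (tr r x ≟ 0#) then + 1 else negℤ (+ 1)

  nonzero : List Carrier
  nonzero = filter (λ x → ¬? (x ≟ 0#)) elements

  K : ℕ → Carrier → ℤ
  K r a = sumℤ (map (λ α → lam r (α + a * (α ⁻¹))) nonzero)

  T₀K : ℕ → ℤ
  T₀K r = sumℤ (map (K r) (filter (λ a → tr r a ≟ 0#) nonzero))

  T₁K : ℕ → ℤ
  T₁K r = sumℤ (map (K r) (filter (λ a → tr r a ≟ 1#) nonzero))

{-# OPTIONS --safe #-}
module Submission where

-- The map ψ(x) = (-1)^tr(x) is a character of (F_q, +): the trace is additive because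
-- squaring is additive in characteristic 2, and tr(x) ∈ {0, 1} because
-- tr(x)² + tr(x) = x^q + x = 0. It is nontrivial, since tr is a polynomial of degree
-- 2^(r-1) < q and so cannot vanish on all of F_q. Hence Σ_{a≠0} ψ(aγ) is q - 1 for γ = 0
-- and -1 otherwise. Writing ψ(ca)ψ(α + aα⁻¹) = ψ(α)ψ(a(c + α⁻¹)) and exchanging the two
-- sums gives Σ_a ψ(ca) K(a) = Σ_α ψ(α) Σ_a ψ(a(c + α⁻¹)), which is 1 for c = 0 and
-- ψ(1) q + 1 for c = 1 (only α = 1 makes 1 + α⁻¹ vanish). Finally 2 T₀K and 2 T₁K are
-- the sum and the difference of these two values, and ψ(1) = (-1)^r.

open import Defs
open import Level using (Level; 0ℓ)
open import Algebra.Core using (Op₂)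
open import Algebra.Bundles using (CommutativeMonoid; CommutativeRing)
open import Algebra.Structures using (IsCommutativeMonoid; IsCommutativeRing)
import Tactic.RingSolver.Core.AlmostCommutativeRing as ACR
open import Data.Bool using (true; false; if_then_else_)
open import Data.Integer using (ℤ; -1ℤ)
import Data.Integer as ℤ
import Data.Integer.Properties as ℤP
open import Data.List using (List; []; _∷_; foldr; map; filter; length)
open import Data.List.Properties using (map-∘)
open import Data.List.Membership.Propositional using (_∈_)
open import Data.List.Membership.Propositional.Properties using (∈-filter⁺; ∈-filter⁻; ∈-map⁺; ∈-map⁻)
open import Data.List.Membership.Propositional.Properties.WithK using (unique∧set⇒bag)
open import Data.List.Relation.Binary.BagAndSetEquality using (∼bag⇒↭)
open import Data.List.Relation.Binary.Permutation.Propositional using (_↭_; ↭⇒↭ₛ)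
import Data.List.Relation.Binary.Permutation.Propositional.Properties as Perm
open import Data.List.Relation.Binary.Permutation.Setoid.Properties using (foldr-commMonoid)
open import Data.List.Relation.Unary.All as All using (All; []; _∷_)
open import Data.List.Relation.Unary.All.Properties using (¬All⇒Any¬)
open import Data.List.Relation.Unary.Any using (here; there; satisfied)
open import Data.List.Relation.Unary.Unique.Propositional using (Unique; []; _∷_)
import Data.List.Relation.Unary.Unique.Propositional.Properties as Unique
open import Data.Maybe using (nothing)
import Data.Nat as ℕ
open import Data.Nat using (ℕ; zero; suc; _≤_; _<_; s≤s; z≤n)
open import Data.Nat.Divisibility using (_∣_; divides; m∣m*n)
import Data.Nat.Properties as ℕ
open import Data.Product using (_,_; proj₁; proj₂; ∃; uncurry)
open import Data.Sum using (_⊎_; inj₁; inj₂)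
open import Function using (id; _∘_; _⇔_; mk⇔)
open import Relation.Binary.Definitions using (DecidableEquality)
open import Relation.Binary.PropositionalEquality
open import Relation.Nullary using (yes; no; does; ¬?; contradiction)
open import Relation.Nullary.Decidable using (dec-true; dec-false)
open import Relation.Unary using (Pred; Decidable)

private variable
  a c : Level
  A : Set a

↭-fromUnique : {xs ys : List A} → Unique xs → Unique ys → (∀ {x} → x ∈ xs ⇔ x ∈ ys) → xs ↭ ys
↭-fromUnique !xs !ys same = ∼bag⇒↭ (unique∧set⇒bag !xs !ys same)

module Without {A : Set a} (_≟_ : DecidableEquality A) where

  _without_ : List A → A → List A
  xs without z = filter (λ x → ¬? (x ≟ z)) xs

  ↭-without : ∀ {z xs} → Unique xs → z ∈ xs → xs ↭ z ∷ (xs without z)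
  ↭-without {z} {xs} !xs z∈xs = ↭-fromUnique !xs
      (All.tabulate (λ y∈ z≡y → proj₂ (∈-filter⁻ _ {xs = xs} y∈) (sym z≡y)) ∷ Unique.filter⁺ _ !xs)
      (mk⇔ to from)
    where
      to : ∀ {x} → x ∈ xs → x ∈ z ∷ (xs without z)
      to {x} x∈xs with x ≟ z
      ... | yes refl = here refl
      ... | no x≢z   = there (∈-filter⁺ _ x∈xs x≢z)
      from : ∀ {x} → x ∈ z ∷ (xs without z) → x ∈ xs
      from (here refl) = z∈xs
      from (there x∈)  = proj₁ (∈-filter⁻ _ {xs = xs} x∈)

module ListSum {C : Set c} {_∙_ : Op₂ C} {ε : C}
  (isCommutativeMonoid : IsCommutativeMonoid _≡_ _∙_ ε) where

  private
    commutativeMonoid : CommutativeMonoid c c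
    commutativeMonoid = record { isCommutativeMonoid = isCommutativeMonoid }

  open IsCommutativeMonoid isCommutativeMonoid using (identityˡ)
  open import Algebra.Properties.CommutativeSemigroup (CommutativeMonoid.commutativeSemigroup commutativeMonoid)
    using (interchange)
  open ≡-Reasoning

  ∑ : List A → (A → C) → C
  ∑ xs f = foldr _∙_ ε (map f xs)

  syntax ∑ xs (λ x → e) = ∑[ x ∈ xs ] e

  ∑-cong : ∀ xs {f g : A → C} → (∀ {x} → x ∈ xs → f x ≡ g x) → ∑ xs f ≡ ∑ xs g
  ∑-cong []       f≗g = refl
  ∑-cong (x ∷ xs) f≗g = cong₂ _∙_ (f≗g (here refl)) (∑-cong xs (f≗g ∘ there))

  ∑-ε : ∀ (xs : List A) → ∑[ _ ∈ xs ] ε ≡ ε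
  ∑-ε []       = refl
  ∑-ε (x ∷ xs) = trans (identityˡ _) (∑-ε xs)

  ∑-distrib : ∀ xs (f g : A → C) → ∑[ x ∈ xs ] (f x ∙ g x) ≡ ∑ xs f ∙ ∑ xs g
  ∑-distrib []       f g = sym (identityˡ ε)
  ∑-distrib (x ∷ xs) f g = trans (cong ((f x ∙ g x) ∙_) (∑-distrib xs f g))
                                 (interchange (f x) (g x) (∑ xs f) (∑ xs g))

  ∑-comm : ∀ {b} {B : Set b} xs (ys : List B) (f : A → B → C) →
           ∑[ x ∈ xs ] ∑[ y ∈ ys ] f x y ≡ ∑[ y ∈ ys ] ∑[ x ∈ xs ] f x y
  ∑-comm []       ys f = sym (∑-ε ys)
  ∑-comm (x ∷ xs) ys f = trans (cong (∑ ys (f x) ∙_) (∑-comm xs ys f))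
                               (sym (∑-distrib ys (f x) (λ y → ∑[ x ∈ xs ] f x y)))

  ∑-↭ : ∀ {xs ys} (f : A → C) → xs ↭ ys → ∑ xs f ≡ ∑ ys f
  ∑-↭ f xs↭ys = foldr-commMonoid (setoid _) isCommutativeMonoid (↭⇒↭ₛ (Perm.map⁺ f xs↭ys))

  ∑-reindex : ∀ {xs} (f : A → C) (σ τ : A → A) → Unique xs →
              (∀ {x} → x ∈ xs → σ x ∈ xs) → (∀ {x} → x ∈ xs → τ x ∈ xs) →
              (∀ x → σ (τ x) ≡ x) → (∀ x → τ (σ x) ≡ x) →
              ∑[ x ∈ xs ] f (σ x) ≡ ∑ xs f
  ∑-reindex {xs = xs} f σ τ !xs σ∈ τ∈ στ τσ = begin
    ∑ xs (f ∘ σ)    ≡⟨ cong (foldr _∙_ ε) (map-∘ xs) ⟩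
    ∑ (map σ xs) f  ≡⟨ ∑-↭ f (↭-fromUnique (Unique.map⁺ σ-injective !xs) !xs (mk⇔ to from)) ⟩
    ∑ xs f          ∎
    where
      σ-injective : ∀ {x y} → σ x ≡ σ y → x ≡ y
      σ-injective {x} {y} σx≡σy = trans (sym (τσ x)) (trans (cong τ σx≡σy) (τσ y))
      to : ∀ {y} → y ∈ map σ xs → y ∈ xs
      to y∈ with ∈-map⁻ σ y∈
      ... | x , x∈xs , refl = σ∈ x∈xs
      from : ∀ {y} → y ∈ xs → y ∈ map σ xs
      from {y} y∈xs = subst (_∈ map σ xs) (στ y) (∈-map⁺ σ (τ∈ y∈xs))

  ∑-filter : ∀ {p} {P : Pred A p} (P? : Decidable P) xs (f : A → C) →
             ∑ (filter P? xs) f ≡ ∑[ x ∈ xs ] (if does (P? x) then f x else ε)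
  ∑-filter P? []       f = refl
  ∑-filter P? (x ∷ xs) f with does (P? x)
  ... | true  = cong (f x ∙_) (∑-filter P? xs f)
  ... | false = trans (∑-filter P? xs f) (sym (identityˡ _))

  module _ (_≟_ : DecidableEquality A) where
    open Without _≟_

    ∑-without : ∀ {z xs} (f : A → C) → Unique xs → z ∈ xs → ∑ xs f ≡ f z ∙ ∑ (xs without z) f
    ∑-without f !xs z∈xs = ∑-↭ f (↭-without !xs z∈xs)

module IntegerSum where

  open ListSum ℤP.+-0-isCommutativeMonoid public
  open import Data.Integer using (+_; _+_; _*_)

  ∑-*ˡ : ∀ xs c (f : A → ℤ) → ∑[ x ∈ xs ] (c * f x) ≡ c * ∑ xs f
  ∑-*ˡ []       c f = sym (ℤP.*-zeroʳ c)
  ∑-*ˡ (x ∷ xs) c f = trans (cong (λ s → c * f x + s) (∑-*ˡ xs c f)) (sym (ℤP.*-distribˡ-+ c (f x) (∑ xs f)))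

  ∑-*ʳ : ∀ xs (f : A → ℤ) c → ∑[ x ∈ xs ] (f x * c) ≡ ∑ xs f * c
  ∑-*ʳ xs f c = trans (∑-cong xs (λ {x} _ → ℤP.*-comm (f x) c)) (trans (∑-*ˡ xs c f) (ℤP.*-comm c (∑ xs f)))

  ∑-ones : ∀ (xs : List A) → ∑[ _ ∈ xs ] (+ 1) ≡ + length xs
  ∑-ones []       = refl
  ∑-ones (_ ∷ xs) = cong (λ s → + 1 + s) (∑-ones xs)

i≡-i⇒i≡0 : ∀ {i} → i ≡ ℤ.- i → i ≡ ℤ.+ 0
i≡-i⇒i≡0 {ℤ.+ zero}    _ = refl
i≡-i⇒i≡0 {ℤ.+[1+ n ]} ()
i≡-i⇒i≡0 {ℤ.-[1+ n ]} ()

1+i≡j⇒i≡j-1 : ∀ {i j} → ℤ.+ 1 ℤ.+ i ≡ j → i ≡ j ℤ.- ℤ.+ 1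
1+i≡j⇒i≡j-1 {i} refl = i≡1+i-1 i
  where
    open import Data.Integer using (+_; _+_; _-_)
    open import Data.Integer.Tactic.RingSolver using (solve-∀)
    i≡1+i-1 : ∀ i → i ≡ + 1 + i - + 1
    i≡1+i-1 = solve-∀

module FiniteFieldProperties (F : FiniteField) where

  open FiniteField F
  open IsCommutativeRing isCommutativeRing
    using ( +-assoc; +-identityˡ; +-identityʳ; -‿inverseʳ; *-assoc; *-comm; *-identityˡ; *-identityʳ
          ; distribˡ; distribʳ; zeroˡ; zeroʳ; *-isCommutativeMonoid)

  commutativeRing : CommutativeRing 0ℓ 0ℓ
  commutativeRing = record { isCommutativeRing = isCommutativeRing }

  almostCommutativeRing : ACR.AlmostCommutativeRing 0ℓ 0ℓ
  almostCommutativeRing = ACR.fromCommutativeRing commutativeRing (λ _ → nothing)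

  open CommutativeRing commutativeRing using (ring; commutativeSemiring; +-commutativeSemigroup)
  open import Algebra.Properties.Ring ring using (+-cancelʳ; -1*x≈-x; -‿involutive)
  open import Algebra.Properties.CommutativeSemigroup +-commutativeSemigroup using (interchange)
  open import Algebra.Properties.CommutativeSemiring.Exp commutativeSemiring using (^-homo-*; ^-distrib-*)
  open import Algebra.Properties.CommutativeSemiring.Exp commutativeSemiring using (_^_) public
  open import Tactic.RingSolver.NonReflective almostCommutativeRing using (solve; _⊜_; _⊕_; _⊗_)
  open ListSum *-isCommutativeMonoid using () renaming (∑ to ∏; ∑-distrib to ∏-distrib; ∑-reindex to ∏-reindex)
  open Without _≟_
  open ≡-Reasoning

  pow≡^ : ∀ x n → pow F x n ≡ x ^ n
  pow≡^ x zero    = refl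
  pow≡^ x (suc n) = cong (x *_) (pow≡^ x n)

  1^n≡1 : ∀ n → 1# ^ n ≡ 1#
  1^n≡1 zero    = refl
  1^n≡1 (suc n) = trans (*-identityˡ _) (1^n≡1 n)

  ^-double : ∀ x n → x ^ (2 ℕ.* n) ≡ x ^ n * x ^ n
  ^-double x n = trans (cong (x ^_) (cong (n ℕ.+_) (ℕ.+-identityʳ n))) (^-homo-* x n n)

  x*y*y⁻¹≡x : ∀ x {y} → y ≢ 0# → x * y * y ⁻¹ ≡ x
  x*y*y⁻¹≡x x {y} y≢0 = trans (*-assoc x y (y ⁻¹)) (trans (cong (x *_) (⁻¹-inverse y y≢0)) (*-identityʳ x))

  x*y⁻¹*y≡x : ∀ x {y} → y ≢ 0# → x * y ⁻¹ * y ≡ x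
  x*y⁻¹*y≡x x {y} y≢0 = trans (*-assoc x (y ⁻¹) y)
    (trans (cong (x *_) (trans (*-comm (y ⁻¹) y) (⁻¹-inverse y y≢0))) (*-identityʳ x))

  *-cancelʳ-nonzero : ∀ {x y z} → z ≢ 0# → x * z ≡ y * z → x ≡ y
  *-cancelʳ-nonzero {x} {y} {z} z≢0 xz≡yz = begin
    x            ≡⟨ sym (x*y*y⁻¹≡x x z≢0) ⟩
    x * z * z ⁻¹ ≡⟨ cong (_* z ⁻¹) xz≡yz ⟩
    y * z * z ⁻¹ ≡⟨ x*y*y⁻¹≡x y z≢0 ⟩
    y            ∎

  x*y≡0⇒y≡0 : ∀ {x y} → x ≢ 0# → x * y ≡ 0# → y ≡ 0#
  x*y≡0⇒y≡0 {x} {y} x≢0 xy≡0 = *-cancelʳ-nonzero x≢0 (trans (*-comm y x) (trans xy≡0 (sym (zeroˡ x))))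

  *-nonzero : ∀ {x y} → x ≢ 0# → y ≢ 0# → x * y ≢ 0#
  *-nonzero x≢0 y≢0 = y≢0 ∘ x*y≡0⇒y≡0 x≢0

  ⁻¹-nonzero : ∀ {x} → x ≢ 0# → x ⁻¹ ≢ 0#
  ⁻¹-nonzero {x} x≢0 x⁻¹≡0 = 0≢1 (trans (sym (zeroʳ x)) (trans (cong (x *_) (sym x⁻¹≡0)) (⁻¹-inverse x x≢0)))

  1⁻¹≡1 : 1# ⁻¹ ≡ 1#
  1⁻¹≡1 = trans (sym (*-identityˡ (1# ⁻¹))) (⁻¹-inverse 1# (0≢1 ∘ sym))

  nonzero-unique : Unique (nonzero F)
  nonzero-unique = Unique.filter⁺ _ elements-unique

  ∈-nonzero⁺ : ∀ {x} → x ≢ 0# → x ∈ nonzero F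
  ∈-nonzero⁺ x≢0 = ∈-filter⁺ _ (elements-complete _) x≢0

  ∈-nonzero⁻ : ∀ {x} → x ∈ nonzero F → x ≢ 0#
  ∈-nonzero⁻ x∈ = proj₂ (∈-filter⁻ _ {xs = elements} x∈)

  elements↭0∷nonzero : elements ↭ 0# ∷ nonzero F
  elements↭0∷nonzero = ↭-without elements-unique (elements-complete 0#)

  order≡1+∣nonzero∣ : order F ≡ suc (length (nonzero F))
  order≡1+∣nonzero∣ = Perm.↭-length elements↭0∷nonzero

  ∏-const : ∀ (xs : List Carrier) x → ∏ xs (λ _ → x) ≡ x ^ length xs
  ∏-const []       x = refl
  ∏-const (_ ∷ xs) x = cong (x *_) (∏-const xs x)

  ∏-nonzero : ∀ xs → (∀ {x} → x ∈ xs → x ≢ 0#) → ∏ xs id ≢ 0#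
  ∏-nonzero []       _    = 0≢1 ∘ sym
  ∏-nonzero (x ∷ xs) xs≢0 = *-nonzero (xs≢0 (here refl)) (∏-nonzero xs (xs≢0 ∘ there))

  x^∣nonzero∣≡1 : ∀ {x} → x ≢ 0# → x ^ length (nonzero F) ≡ 1#
  x^∣nonzero∣≡1 {x} x≢0 = *-cancelʳ-nonzero (∏-nonzero N ∈-nonzero⁻) (begin
    x ^ length N * P        ≡⟨ *-comm _ P ⟩
    P * x ^ length N        ≡⟨ cong (P *_) (sym (∏-const N x)) ⟩
    P * ∏ N (λ _ → x)       ≡⟨ sym (∏-distrib N id (λ _ → x)) ⟩
    ∏ N (_* x)              ≡⟨ ∏-reindex id (_* x) (_* x ⁻¹) nonzero-unique
                                 (λ y∈ → ∈-nonzero⁺ (*-nonzero (∈-nonzero⁻ y∈) x≢0))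
                                 (λ y∈ → ∈-nonzero⁺ (*-nonzero (∈-nonzero⁻ y∈) (⁻¹-nonzero x≢0)))
                                 (λ y → x*y⁻¹*y≡x y x≢0) (λ y → x*y*y⁻¹≡x y x≢0) ⟩
    P                       ≡⟨ sym (*-identityˡ P) ⟩
    1# * P                  ∎)
    where
      N = nonzero F
      P = ∏ N id

  x^order≡x : ∀ x → x ^ order F ≡ x
  x^order≡x x rewrite order≡1+∣nonzero∣ with x ≟ 0#
  ... | yes refl = zeroˡ _
  ... | no x≢0   = trans (cong (x *_) (x^∣nonzero∣≡1 x≢0)) (*-identityʳ x)

  1+1≡0 : 2 ∣ order F → 1# + 1# ≡ 0#
  1+1≡0 (divides k order≡k*2) = trans (cong (1# +_) 1≡-1) (-‿inverseʳ 1#)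
    where
      1≡-1 : 1# ≡ - 1#
      1≡-1 = begin
        1#                       ≡⟨ sym (1^n≡1 k) ⟩
        1# ^ k                   ≡⟨ cong (_^ k) (sym (trans (-1*x≈-x (- 1#)) (-‿involutive 1#))) ⟩
        (- 1# * - 1#) ^ k        ≡⟨ ^-distrib-* (- 1#) (- 1#) k ⟩
        (- 1#) ^ k * (- 1#) ^ k  ≡⟨ sym (^-double (- 1#) k) ⟩
        (- 1#) ^ (2 ℕ.* k)       ≡⟨ cong ((- 1#) ^_) (trans (ℕ.*-comm 2 k) (sym order≡k*2)) ⟩
        (- 1#) ^ order F         ≡⟨ x^order≡x (- 1#) ⟩
        - 1#                     ∎

  IsBit : Carrier → Set
  IsBit x = x ≡ 0# ⊎ x ≡ 1#

  sign : Carrier → ℤ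
  sign t = if does (t ≟ 0#) then ℤ.+ 1 else ℤ.- ℤ.+ 1

  sign-0 : sign 0# ≡ ℤ.+ 1
  sign-0 = cong (if_then ℤ.+ 1 else ℤ.- ℤ.+ 1) (dec-true (0# ≟ 0#) refl)

  sign-nonzero : ∀ {t} → t ≢ 0# → sign t ≡ -1ℤ
  sign-nonzero {t} t≢0 = cong (if_then ℤ.+ 1 else ℤ.- ℤ.+ 1) (dec-false (t ≟ 0#) t≢0)

  sign-1 : sign 1# ≡ -1ℤ
  sign-1 = sign-nonzero (0≢1 ∘ sym)

  module Characteristic2 (1+1≡0 : 1# + 1# ≡ 0#) where

    x+x≡0 : ∀ x → x + x ≡ 0#
    x+x≡0 x = begin
      x + x             ≡⟨ cong₂ _+_ (sym (*-identityˡ x)) (sym (*-identityˡ x)) ⟩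
      1# * x + 1# * x   ≡⟨ sym (distribʳ x 1# 1#) ⟩
      (1# + 1#) * x     ≡⟨ cong (_* x) 1+1≡0 ⟩
      0# * x            ≡⟨ zeroˡ x ⟩
      0#                ∎

    x+y+y≡x : ∀ x y → x + y + y ≡ x
    x+y+y≡x x y = trans (+-assoc x y y) (trans (cong (x +_) (x+x≡0 y)) (+-identityʳ x))

    x+y≡0⇒x≡y : ∀ {x y} → x + y ≡ 0# → x ≡ y
    x+y≡0⇒x≡y {x} {y} x+y≡0 = +-cancelʳ y x y (trans x+y≡0 (sym (x+x≡0 y)))

    1+x⁻¹≢0 : ∀ {x} → x ≢ 0# → x ≢ 1# → 1# + x ⁻¹ ≢ 0#
    1+x⁻¹≢0 {x} x≢0 x≢1 1+x⁻¹≡0 = x≢1 (begin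
      x          ≡⟨ sym (*-identityʳ x) ⟩
      x * 1#     ≡⟨ cong (x *_) (x+y≡0⇒x≡y 1+x⁻¹≡0) ⟩
      x * x ⁻¹   ≡⟨ ⁻¹-inverse x x≢0 ⟩
      1#         ∎)

    square-+ : ∀ x y → (x + y) * (x + y) ≡ x * x + y * y
    square-+ x y = begin
      (x + y) * (x + y)                ≡⟨ solve 2 (λ x y → ((x ⊕ y) ⊗ (x ⊕ y)) ⊜ (x ⊗ x ⊕ y ⊗ y ⊕ (x ⊗ y ⊕ x ⊗ y))) refl x y ⟩
      x * x + y * y + (x * y + x * y)  ≡⟨ cong (x * x + y * y +_) (x+x≡0 (x * y)) ⟩
      x * x + y * y + 0#               ≡⟨ +-identityʳ _ ⟩
      x * x + y * y                    ∎

    frobenius : ∀ n x y → (x + y) ^ (2 ℕ.^ n) ≡ x ^ (2 ℕ.^ n) + y ^ (2 ℕ.^ n)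
    frobenius zero    x y = distribʳ 1# x y
    frobenius (suc n) x y = begin
      (x + y) ^ (2 ℕ.* 2 ℕ.^ n)                  ≡⟨ ^-double (x + y) (2 ℕ.^ n) ⟩
      (x + y) ^ (2 ℕ.^ n) * (x + y) ^ (2 ℕ.^ n)  ≡⟨ cong₂ _*_ (frobenius n x y) (frobenius n x y) ⟩
      (X + Y) * (X + Y)                          ≡⟨ square-+ X Y ⟩
      X * X + Y * Y                              ≡⟨ sym (cong₂ _+_ (^-double x (2 ℕ.^ n)) (^-double y (2 ℕ.^ n))) ⟩
      x ^ (2 ℕ.* 2 ℕ.^ n) + y ^ (2 ℕ.* 2 ℕ.^ n)  ∎
      where X = x ^ (2 ℕ.^ n)
            Y = y ^ (2 ℕ.^ n)

    idempotent⇒bit : ∀ {x} → x * x ≡ x → IsBit x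
    idempotent⇒bit {x} x*x≡x with x ≟ 0#
    ... | yes x≡0 = inj₁ x≡0
    ... | no x≢0  = inj₂ (x+y≡0⇒x≡y (x*y≡0⇒y≡0 x≢0 (begin
      x * (x + 1#)     ≡⟨ distribˡ x x 1# ⟩
      x * x + x * 1#   ≡⟨ cong₂ _+_ x*x≡x (*-identityʳ x) ⟩
      x + x            ≡⟨ x+x≡0 x ⟩
      0#               ∎)))

    sign-+ : ∀ {s t} → IsBit s → IsBit t → sign (s + t) ≡ sign s ℤ.* sign t
    sign-+ {t = t} (inj₁ refl) _ = begin
      sign (0# + t)          ≡⟨ cong sign (+-identityˡ t) ⟩
      sign t                 ≡⟨ sym (ℤP.*-identityˡ (sign t)) ⟩
      ℤ.+ 1 ℤ.* sign t       ≡⟨ cong (ℤ._* sign t) (sym sign-0) ⟩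
      sign 0# ℤ.* sign t     ∎
    sign-+ (inj₂ refl) (inj₁ refl) = begin
      sign (1# + 0#)         ≡⟨ cong sign (+-identityʳ 1#) ⟩
      sign 1#                ≡⟨ sym (ℤP.*-identityʳ (sign 1#)) ⟩
      sign 1# ℤ.* ℤ.+ 1      ≡⟨ cong (sign 1# ℤ.*_) (sym sign-0) ⟩
      sign 1# ℤ.* sign 0#    ∎
    sign-+ (inj₂ refl) (inj₂ refl) = begin
      sign (1# + 1#)         ≡⟨ cong sign 1+1≡0 ⟩
      sign 0#                ≡⟨ sign-0 ⟩
      -1ℤ ℤ.* -1ℤ            ≡⟨ sym (cong₂ ℤ._*_ sign-1 sign-1) ⟩
      sign 1# ℤ.* sign 1#    ∎

    traceSum-suc : ∀ n x → traceSum F (suc n) x ≡ traceSum F n x + x ^ (2 ℕ.^ n)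
    traceSum-suc n x = cong (traceSum F n x +_) (pow≡^ x (2 ℕ.^ n))

    traceSum-+ : ∀ n x y → traceSum F n (x + y) ≡ traceSum F n x + traceSum F n y
    traceSum-+ zero    x y = sym (+-identityˡ 0#)
    traceSum-+ (suc n) x y = begin
      traceSum F (suc n) (x + y)                                           ≡⟨ traceSum-suc n (x + y) ⟩
      traceSum F n (x + y) + (x + y) ^ (2 ℕ.^ n)                           ≡⟨ cong₂ _+_ (traceSum-+ n x y) (frobenius n x y) ⟩
      traceSum F n x + traceSum F n y + (x ^ (2 ℕ.^ n) + y ^ (2 ℕ.^ n))    ≡⟨ interchange _ _ _ _ ⟩
      traceSum F n x + x ^ (2 ℕ.^ n) + (traceSum F n y + y ^ (2 ℕ.^ n))    ≡⟨ sym (cong₂ _+_ (traceSum-suc n x) (traceSum-suc n y)) ⟩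
      traceSum F (suc n) x + traceSum F (suc n) y                          ∎

    traceSum-0 : ∀ n → traceSum F n 0# ≡ 0#
    traceSum-0 n = begin
      traceSum F n 0#                    ≡⟨ cong (traceSum F n) (sym (+-identityˡ 0#)) ⟩
      traceSum F n (0# + 0#)             ≡⟨ traceSum-+ n 0# 0# ⟩
      traceSum F n 0# + traceSum F n 0#  ≡⟨ x+x≡0 _ ⟩
      0#                                 ∎

    traceSum-square : ∀ n x → traceSum F n x * traceSum F n x + x ≡ traceSum F n x + x ^ (2 ℕ.^ n)
    traceSum-square zero    x = cong₂ _+_ (zeroˡ 0#) (sym (*-identityʳ x))
    traceSum-square (suc n) x = begin
      T′ * T′ + x                ≡⟨ cong (λ t → t * t + x) (traceSum-suc n x) ⟩
      (T + p) * (T + p) + x      ≡⟨ cong (_+ x) (square-+ T p) ⟩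
      T * T + p * p + x          ≡⟨ solve 3 (λ a b c → (a ⊕ b ⊕ c) ⊜ (a ⊕ c ⊕ b)) refl (T * T) (p * p) x ⟩
      T * T + x + p * p          ≡⟨ cong₂ _+_ (traceSum-square n x) (sym (^-double x (2 ℕ.^ n))) ⟩
      T + p + x ^ (2 ℕ.^ suc n)  ≡⟨ cong (_+ x ^ (2 ℕ.^ suc n)) (sym (traceSum-suc n x)) ⟩
      T′ + x ^ (2 ℕ.^ suc n)     ∎
      where T′ = traceSum F (suc n) x
            T = traceSum F n x
            p = x ^ (2 ℕ.^ n)

    traceSum-bit : ∀ n {x} → x ^ (2 ℕ.^ n) ≡ x → IsBit (traceSum F n x)
    traceSum-bit n {x} x^2^n≡x = idempotent⇒bit
      (+-cancelʳ x _ _ (trans (traceSum-square n x) (cong (traceSum F n x +_) x^2^n≡x)))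

    traceSum-bit-order : ∀ {n} → order F ≡ 2 ℕ.^ n → ∀ x → IsBit (traceSum F n x)
    traceSum-bit-order {n} order≡2^n x = traceSum-bit n (subst (λ m → x ^ m ≡ x) order≡2^n (x^order≡x x))

    sign-traceSum-1 : ∀ n → sign (traceSum F n 1#) ≡ -1ℤ ℤ.^ n
    sign-traceSum-1 zero    = sign-0
    sign-traceSum-1 (suc n) = begin
      sign (traceSum F (suc n) 1#)             ≡⟨ cong sign (traceSum-suc n 1#) ⟩
      sign (traceSum F n 1# + 1# ^ 2 ℕ.^ n)    ≡⟨ cong (λ t → sign (traceSum F n 1# + t)) (1^n≡1 (2 ℕ.^ n)) ⟩
      sign (traceSum F n 1# + 1#)              ≡⟨ sign-+ (traceSum-bit n (1^n≡1 (2 ℕ.^ n))) (inj₂ refl) ⟩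
      sign (traceSum F n 1#) ℤ.* sign 1#       ≡⟨ cong₂ ℤ._*_ (sign-traceSum-1 n) sign-1 ⟩
      -1ℤ ℤ.^ n ℤ.* -1ℤ                        ≡⟨ ℤP.*-comm (-1ℤ ℤ.^ n) -1ℤ ⟩
      -1ℤ ℤ.^ suc n                            ∎

module Polynomials (F : FiniteField) where

  open FiniteField F
  open IsCommutativeRing isCommutativeRing using (+-identityˡ; +-identityʳ; zeroʳ)
  open FiniteFieldProperties F
  open import Tactic.RingSolver.NonReflective almostCommutativeRing using (solve; _⊜_; _⊕_; _⊗_)
  open ≡-Reasoning

  Poly : Set
  Poly = List Carrier

  eval : Poly → Carrier → Carrier
  eval []      x = 0#
  eval (a ∷ p) x = a + x * eval p x

  coeff : ℕ → Poly → Carrier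
  coeff _       []      = 0#
  coeff zero    (a ∷ p) = a
  coeff (suc i) (a ∷ p) = coeff i p

  IsZero : Poly → Set
  IsZero = All (_≡ 0#)

  infixl 6 _+ₚ_

  _+ₚ_ : Poly → Poly → Poly
  []      +ₚ q       = q
  (a ∷ p) +ₚ []      = a ∷ p
  (a ∷ p) +ₚ (b ∷ q) = (a + b) ∷ (p +ₚ q)

  X^ : ℕ → Poly
  X^ zero    = 1# ∷ []
  X^ (suc n) = 0# ∷ X^ n

  a+x*0≡a : ∀ a x → a + x * 0# ≡ a
  a+x*0≡a a x = trans (cong (a +_) (zeroʳ x)) (+-identityʳ a)

  eval-+ₚ : ∀ p q x → eval (p +ₚ q) x ≡ eval p x + eval q x
  eval-+ₚ []      q       x = sym (+-identityˡ _)
  eval-+ₚ (a ∷ p) []      x = sym (+-identityʳ _)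
  eval-+ₚ (a ∷ p) (b ∷ q) x = begin
    a + b + x * eval (p +ₚ q) x            ≡⟨ cong (λ t → a + b + x * t) (eval-+ₚ p q x) ⟩
    a + b + x * (eval p x + eval q x)      ≡⟨ solve 5 (λ a b x u v → (a ⊕ b ⊕ x ⊗ (u ⊕ v)) ⊜ (a ⊕ x ⊗ u ⊕ (b ⊕ x ⊗ v)))
                                                refl a b x (eval p x) (eval q x) ⟩
    a + x * eval p x + (b + x * eval q x)  ∎

  eval-X^ : ∀ n x → eval (X^ n) x ≡ x ^ n
  eval-X^ zero    x = a+x*0≡a 1# x
  eval-X^ (suc n) x = trans (+-identityˡ _) (cong (x *_) (eval-X^ n x))

  length-+ₚ : ∀ p q → length (p +ₚ q) ≡ length p ℕ.⊔ length q
  length-+ₚ []      q       = refl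
  length-+ₚ (a ∷ p) []      = refl
  length-+ₚ (a ∷ p) (b ∷ q) = cong suc (length-+ₚ p q)

  length-X^ : ∀ n → length (X^ n) ≡ suc n
  length-X^ zero    = refl
  length-X^ (suc n) = cong suc (length-X^ n)

  coeff-+ₚ : ∀ i p q → coeff i (p +ₚ q) ≡ coeff i p + coeff i q
  coeff-+ₚ i       []      q       = sym (+-identityˡ _)
  coeff-+ₚ i       (a ∷ p) []      = sym (+-identityʳ _)
  coeff-+ₚ zero    (a ∷ p) (b ∷ q) = refl
  coeff-+ₚ (suc i) (a ∷ p) (b ∷ q) = coeff-+ₚ i p q

  coeff₁-X^ : ∀ {n} → 2 ≤ n → coeff 1 (X^ n) ≡ 0#
  coeff₁-X^ (s≤s (s≤s _)) = refl

  coeff-zero : ∀ i {p} → IsZero p → coeff i p ≡ 0#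
  coeff-zero i       []              = refl
  coeff-zero zero    (a≡0 ∷ _)       = a≡0
  coeff-zero (suc i) (_ ∷ p-is-zero) = coeff-zero i p-is-zero

  quotient : Carrier → Poly → Poly
  quotient c []          = []
  quotient c (a ∷ [])    = []
  quotient c (a ∷ b ∷ p) = eval (b ∷ p) c ∷ quotient c (b ∷ p)

  -- p = (X - c) · quotient c p + p(c), with c · quotient c p moved across so that no subtraction occurs
  eval-quotient : ∀ c p x → eval p x + c * eval (quotient c p) x ≡ x * eval (quotient c p) x + eval p c
  eval-quotient c []          x = trans (cong (0# +_) (zeroʳ c)) (cong (_+ 0#) (sym (zeroʳ x)))
  eval-quotient c (a ∷ [])    x =
    solve 4 (λ a x c z → (a ⊕ x ⊗ z ⊕ c ⊗ z) ⊜ (x ⊗ z ⊕ (a ⊕ c ⊗ z))) refl a x c 0#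
  eval-quotient c (a ∷ b ∷ p) x = begin
    a + x * P + c * (e + x * Q)    ≡⟨ solve 6 (λ a x c e P Q → (a ⊕ x ⊗ P ⊕ c ⊗ (e ⊕ x ⊗ Q)) ⊜ (a ⊕ c ⊗ e ⊕ x ⊗ (P ⊕ c ⊗ Q)))
                                        refl a x c e P Q ⟩
    a + c * e + x * (P + c * Q)    ≡⟨ cong (λ t → a + c * e + x * t) (eval-quotient c (b ∷ p) x) ⟩
    a + c * e + x * (x * Q + e)    ≡⟨ solve 5 (λ a x c e Q → (a ⊕ c ⊗ e ⊕ x ⊗ (x ⊗ Q ⊕ e)) ⊜ (x ⊗ (e ⊕ x ⊗ Q) ⊕ (a ⊕ c ⊗ e)))
                                        refl a x c e Q ⟩
    x * (e + x * Q) + (a + c * e)  ∎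
    where P = eval (b ∷ p) x
          Q = eval (quotient c (b ∷ p)) x
          e = eval (b ∷ p) c

  length-quotient : ∀ c p → length (quotient c p) ≡ ℕ.pred (length p)
  length-quotient c []          = refl
  length-quotient c (a ∷ [])    = refl
  length-quotient c (a ∷ b ∷ p) = cong suc (length-quotient c (b ∷ p))

  zero-quotient⇒zero : ∀ c p → IsZero (quotient c p) → eval p c ≡ 0# → IsZero p
  zero-quotient⇒zero c []          _                 _      = []
  zero-quotient⇒zero c (a ∷ [])    _                 p[c]≡0 = trans (sym (a+x*0≡a a c)) p[c]≡0 ∷ []
  zero-quotient⇒zero c (a ∷ b ∷ p) (q[c]≡0 ∷ q-zero) p[c]≡0 =
    trans (sym (trans (cong (λ t → a + c * t) q[c]≡0) (a+x*0≡a a c))) p[c]≡0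
    ∷ zero-quotient⇒zero c (b ∷ p) q-zero q[c]≡0

  roots⇒zero : ∀ {cs} p → Unique cs → All (λ c → eval p c ≡ 0#) cs → length p ≤ length cs → IsZero p
  roots⇒zero {[]}     []      _           _                  _      = []
  roots⇒zero {c ∷ cs} p (c∉cs ∷ !cs) (p[c]≡0 ∷ p[cs]≡0) ∣p∣≤ =
    zero-quotient⇒zero c p
      (roots⇒zero (quotient c p) !cs (All.zipWith (uncurry quotient-root) (c∉cs , p[cs]≡0))
        (subst (_≤ length cs) (sym (length-quotient c p)) (ℕ.pred-mono-≤ ∣p∣≤)))
      p[c]≡0
    where
      quotient-root : ∀ {d} → c ≢ d → eval p d ≡ 0# → eval (quotient c p) d ≡ 0#
      quotient-root {d} c≢d p[d]≡0 with eval (quotient c p) d ≟ 0#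
      ... | yes q[d]≡0 = q[d]≡0
      ... | no q[d]≢0  = contradiction (*-cancelʳ-nonzero q[d]≢0 (begin
        c * eval (quotient c p) d             ≡⟨ sym (+-identityˡ _) ⟩
        0# + c * eval (quotient c p) d        ≡⟨ cong (_+ c * eval (quotient c p) d) (sym p[d]≡0) ⟩
        eval p d + c * eval (quotient c p) d  ≡⟨ eval-quotient c p d ⟩
        d * eval (quotient c p) d + eval p c  ≡⟨ cong (d * eval (quotient c p) d +_) p[c]≡0 ⟩
        d * eval (quotient c p) d + 0#        ≡⟨ +-identityʳ _ ⟩
        d * eval (quotient c p) d             ∎)) c≢d

  tracePoly : ℕ → Poly
  tracePoly zero    = []
  tracePoly (suc n) = tracePoly n +ₚ X^ (2 ℕ.^ n)

  eval-tracePoly : ∀ n x → eval (tracePoly n) x ≡ traceSum F n x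
  eval-tracePoly zero    x = refl
  eval-tracePoly (suc n) x = begin
    eval (tracePoly n +ₚ X^ (2 ℕ.^ n)) x          ≡⟨ eval-+ₚ (tracePoly n) (X^ (2 ℕ.^ n)) x ⟩
    eval (tracePoly n) x + eval (X^ (2 ℕ.^ n)) x  ≡⟨ cong₂ _+_ (eval-tracePoly n x) (eval-X^ (2 ℕ.^ n) x) ⟩
    traceSum F n x + x ^ (2 ℕ.^ n)                ≡⟨ cong (traceSum F n x +_) (sym (pow≡^ x (2 ℕ.^ n))) ⟩
    traceSum F (suc n) x                          ∎

  length-tracePoly : ∀ n → length (tracePoly (suc n)) ≡ suc (2 ℕ.^ n)
  length-tracePoly zero    = refl
  length-tracePoly (suc n) = begin
    length (tracePoly (suc n) +ₚ X^ (2 ℕ.^ suc n))             ≡⟨ length-+ₚ (tracePoly (suc n)) (X^ (2 ℕ.^ suc n)) ⟩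
    length (tracePoly (suc n)) ℕ.⊔ length (X^ (2 ℕ.^ suc n))  ≡⟨ cong₂ ℕ._⊔_ (length-tracePoly n) (length-X^ (2 ℕ.^ suc n)) ⟩
    suc (2 ℕ.^ n) ℕ.⊔ suc (2 ℕ.^ suc n)                       ≡⟨ ℕ.m≤n⇒m⊔n≡n (s≤s (ℕ.^-monoʳ-≤ 2 (ℕ.n≤1+n n))) ⟩
    suc (2 ℕ.^ suc n)                                         ∎

  coeff₁-tracePoly : ∀ n → coeff 1 (tracePoly (suc n)) ≡ 1#
  coeff₁-tracePoly zero    = refl
  coeff₁-tracePoly (suc n) = begin
    coeff 1 (tracePoly (suc n) +ₚ X^ (2 ℕ.^ suc n))           ≡⟨ coeff-+ₚ 1 (tracePoly (suc n)) (X^ (2 ℕ.^ suc n)) ⟩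
    coeff 1 (tracePoly (suc n)) + coeff 1 (X^ (2 ℕ.^ suc n))  ≡⟨ cong₂ _+_ (coeff₁-tracePoly n)
                                                                    (coeff₁-X^ (ℕ.^-monoʳ-≤ 2 {1} {suc n} (s≤s z≤n))) ⟩
    1# + 0#                                                   ≡⟨ +-identityʳ 1# ⟩
    1#                                                        ∎

  traceSum-nonvanishing : ∀ n → 2 ℕ.^ n < order F → ∃ λ c → traceSum F (suc n) c ≢ 0#
  traceSum-nonvanishing n 2^n<q with All.all? (λ c → traceSum F (suc n) c ≟ 0#) elements
  ... | no ¬all = satisfied (¬All⇒Any¬ (λ c → traceSum F (suc n) c ≟ 0#) elements ¬all)
  ... | yes all = contradiction (trans (sym (coeff-zero 1 tracePoly-zero)) (coeff₁-tracePoly n)) 0≢1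
    where
      tracePoly-zero : IsZero (tracePoly (suc n))
      tracePoly-zero = roots⇒zero (tracePoly (suc n)) elements-unique
        (All.map (λ {c} → trans (eval-tracePoly (suc n) c)) all)
        (subst (_≤ order F) (sym (length-tracePoly n)) 2^n<q)

module KloostermanSums (F : FiniteField) (k : ℕ) (order≡2^[1+k] : order F ≡ 2 ℕ.^ suc k) where

  open FiniteField F
    using (Carrier; 0#; 1#; _⁻¹; _≟_; 0≢1; ⁻¹-inverse; elements; elements-unique; elements-complete; isCommutativeRing)
    renaming (_+_ to _+ꟳ_; _*_ to _*ꟳ_)
  open IsCommutativeRing isCommutativeRing using (+-identityˡ; *-identityˡ; zeroˡ; zeroʳ)
  open FiniteFieldProperties F hiding (_^_)
  open Characteristic2 (1+1≡0 (subst (2 ∣_) (sym order≡2^[1+k]) (m∣m*n (2 ℕ.^ k))))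
  open Polynomials F using (traceSum-nonvanishing)
  open import Tactic.RingSolver.NonReflective almostCommutativeRing using (solve; _⊜_; _⊕_; _⊗_)
  open IntegerSum
  open Without _≟_
  open import Data.Integer using (+_; _+_; _*_; _-_; -_; _^_)
  open import Data.Integer.Tactic.RingSolver using (solve-∀)
  open ≡-Reasoning

  r : ℕ
  r = suc k

  -- ψ x unfolds to sign (traceSum F r x).
  ψ : Carrier → ℤ
  ψ = lam F r

  N : List Carrier
  N = nonzero F

  ψ-+ : ∀ x y → ψ (x +ꟳ y) ≡ ψ x * ψ y
  ψ-+ x y = trans (cong sign (traceSum-+ r x y)) (sign-+ (trace-bit x) (trace-bit y))
    where trace-bit = traceSum-bit-order {r} order≡2^[1+k]

  ψ-0 : ψ 0# ≡ + 1
  ψ-0 = trans (cong sign (traceSum-0 r)) sign-0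

  ∑-elements : ∀ (g : Carrier → ℤ) → ∑ elements g ≡ g 0# + ∑ N g
  ∑-elements g = ∑-without _≟_ g elements-unique (elements-complete 0#)

  ∑ψ≡0 : ∑ elements ψ ≡ + 0
  ∑ψ≡0 with traceSum-nonvanishing k (subst (2 ℕ.^ k <_) (sym order≡2^[1+k]) (ℕ.^-monoʳ-< 2 (s≤s (s≤s z≤n)) (ℕ.n<1+n k)))
  ... | c , tr[c]≢0 = i≡-i⇒i≡0 (begin
    ∑ elements ψ                   ≡⟨ sym (∑-reindex ψ (_+ꟳ c) (_+ꟳ c) elements-unique
                                           (λ _ → elements-complete _) (λ _ → elements-complete _)
                                           (λ x → x+y+y≡x x c) (λ x → x+y+y≡x x c)) ⟩
    ∑[ x ∈ elements ] ψ (x +ꟳ c)   ≡⟨ ∑-cong elements (λ {x} _ → trans (ψ-+ x c) (cong (ψ x *_) (sign-nonzero tr[c]≢0))) ⟩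
    ∑[ x ∈ elements ] (ψ x * -1ℤ)  ≡⟨ ∑-*ʳ elements ψ -1ℤ ⟩
    ∑ elements ψ * -1ℤ             ≡⟨ trans (ℤP.*-comm _ -1ℤ) (ℤP.-1*i≡-i _) ⟩
    - ∑ elements ψ                 ∎)

  ∑ψ-nonzero : ∑ N ψ ≡ -1ℤ
  ∑ψ-nonzero = 1+i≡j⇒i≡j-1 (begin
    + 1 + ∑ N ψ   ≡⟨ cong (_+ ∑ N ψ) (sym ψ-0) ⟩
    ψ 0# + ∑ N ψ  ≡⟨ sym (∑-elements ψ) ⟩
    ∑ elements ψ  ≡⟨ ∑ψ≡0 ⟩
    + 0           ∎)

  ψ-sum : Carrier → ℤ
  ψ-sum γ = ∑[ a ∈ N ] ψ (a *ꟳ γ)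

  ψ-sum-nonzero : ∀ {γ} → γ ≢ 0# → ψ-sum γ ≡ -1ℤ
  ψ-sum-nonzero {γ} γ≢0 = 1+i≡j⇒i≡j-1 (begin
    + 1 + ψ-sum γ                 ≡⟨ cong (_+ ψ-sum γ) (sym (trans (cong ψ (zeroˡ γ)) ψ-0)) ⟩
    ψ (0# *ꟳ γ) + ψ-sum γ         ≡⟨ sym (∑-elements (λ a → ψ (a *ꟳ γ))) ⟩
    ∑[ a ∈ elements ] ψ (a *ꟳ γ)  ≡⟨ ∑-reindex ψ (_*ꟳ γ) (_*ꟳ γ ⁻¹) elements-unique
                                        (λ _ → elements-complete _) (λ _ → elements-complete _)
                                        (λ x → x*y⁻¹*y≡x x γ≢0) (λ x → x*y*y⁻¹≡x x γ≢0) ⟩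
    ∑ elements ψ                  ≡⟨ ∑ψ≡0 ⟩
    + 0                           ∎)

  ψ-sum-0 : ψ-sum 0# ≡ + length N
  ψ-sum-0 = trans (∑-cong N (λ {a} _ → trans (cong ψ (zeroʳ a)) ψ-0)) (∑-ones N)

  ∑-twisted : ∀ c → ∑[ a ∈ N ] (ψ (c *ꟳ a) * K F r a) ≡ ∑[ α ∈ N ] (ψ α * ψ-sum (c +ꟳ α ⁻¹))
  ∑-twisted c = begin
    ∑[ a ∈ N ] (ψ (c *ꟳ a) * ∑[ α ∈ N ] ψ (α +ꟳ a *ꟳ α ⁻¹))  ≡⟨ ∑-cong N (λ {a} _ → sym (∑-*ˡ N (ψ (c *ꟳ a)) _)) ⟩
    ∑[ a ∈ N ] ∑[ α ∈ N ] (ψ (c *ꟳ a) * ψ (α +ꟳ a *ꟳ α ⁻¹))  ≡⟨ ∑-comm N N _ ⟩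
    ∑[ α ∈ N ] ∑[ a ∈ N ] (ψ (c *ꟳ a) * ψ (α +ꟳ a *ꟳ α ⁻¹))  ≡⟨ ∑-cong N (λ {α} _ → ∑-cong N (λ {a} _ → regroup a α)) ⟩
    ∑[ α ∈ N ] ∑[ a ∈ N ] (ψ α * ψ (a *ꟳ (c +ꟳ α ⁻¹)))      ≡⟨ ∑-cong N (λ {α} _ → ∑-*ˡ N (ψ α) _) ⟩
    ∑[ α ∈ N ] (ψ α * ψ-sum (c +ꟳ α ⁻¹))                    ∎
    where
      regroup : ∀ a α → ψ (c *ꟳ a) * ψ (α +ꟳ a *ꟳ α ⁻¹) ≡ ψ α * ψ (a *ꟳ (c +ꟳ α ⁻¹))
      regroup a α = begin
        ψ (c *ꟳ a) * ψ (α +ꟳ a *ꟳ α ⁻¹)  ≡⟨ sym (ψ-+ (c *ꟳ a) _) ⟩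
        ψ (c *ꟳ a +ꟳ (α +ꟳ a *ꟳ α ⁻¹))  ≡⟨ cong ψ (solve 4 (λ c a α β → (c ⊗ a ⊕ (α ⊕ a ⊗ β)) ⊜ (α ⊕ a ⊗ (c ⊕ β)))
                                              refl c a α (α ⁻¹)) ⟩
        ψ (α +ꟳ a *ꟳ (c +ꟳ α ⁻¹))        ≡⟨ ψ-+ α _ ⟩
        ψ α * ψ (a *ꟳ (c +ꟳ α ⁻¹))       ∎

  ∑K : ∑ N (K F r) ≡ + 1
  ∑K = begin
    ∑ N (K F r)                            ≡⟨ ∑-cong N (λ {a} _ → sym (untwist a)) ⟩
    ∑[ a ∈ N ] (ψ (0# *ꟳ a) * K F r a)     ≡⟨ ∑-twisted 0# ⟩
    ∑[ α ∈ N ] (ψ α * ψ-sum (0# +ꟳ α ⁻¹))  ≡⟨ ∑-cong N (λ α∈N → cong (ψ _ *_) (ψ-sum-nonzero (0+α⁻¹≢0 α∈N))) ⟩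
    ∑[ α ∈ N ] (ψ α * -1ℤ)                 ≡⟨ ∑-*ʳ N ψ -1ℤ ⟩
    ∑ N ψ * -1ℤ                            ≡⟨ cong (_* -1ℤ) ∑ψ-nonzero ⟩
    + 1                                    ∎
    where
      untwist : ∀ a → ψ (0# *ꟳ a) * K F r a ≡ K F r a
      untwist a = trans (cong (_* K F r a) (trans (cong ψ (zeroˡ a)) ψ-0)) (ℤP.*-identityˡ (K F r a))
      0+α⁻¹≢0 : ∀ {α} → α ∈ N → 0# +ꟳ α ⁻¹ ≢ 0#
      0+α⁻¹≢0 {α} α∈N = ⁻¹-nonzero (∈-nonzero⁻ α∈N) ∘ trans (sym (+-identityˡ (α ⁻¹)))

  ∑ψK : ∑[ a ∈ N ] (ψ a * K F r a) ≡ ψ 1# * + order F + + 1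
  ∑ψK = begin
    ∑[ a ∈ N ] (ψ a * K F r a)                    ≡⟨ ∑-cong N (λ {a} _ → cong (λ b → ψ b * K F r a) (sym (*-identityˡ a))) ⟩
    ∑[ a ∈ N ] (ψ (1# *ꟳ a) * K F r a)            ≡⟨ ∑-twisted 1# ⟩
    ∑[ α ∈ N ] (ψ α * ψ-sum (1# +ꟳ α ⁻¹))         ≡⟨ ∑-without _≟_ _ nonzero-unique 1∈N ⟩
    ψ 1# * ψ-sum (1# +ꟳ 1# ⁻¹) + ∑[ α ∈ N′ ] (ψ α * ψ-sum (1# +ꟳ α ⁻¹))
                                                  ≡⟨ cong₂ _+_ (cong (ψ 1# *_) ψ-sum[1+1⁻¹]) (∑-cong N′ ψ-sum[1+α⁻¹]) ⟩
    ψ 1# * + length N + ∑[ α ∈ N′ ] (ψ α * -1ℤ)   ≡⟨ cong (λ s → ψ 1# * + length N + s) (∑-*ʳ N′ ψ -1ℤ) ⟩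
    ψ 1# * + length N + ∑ N′ ψ * -1ℤ              ≡⟨ cong (λ s → ψ 1# * + length N + s * -1ℤ) ∑N′ψ ⟩
    ψ 1# * + length N + (-1ℤ - ψ 1#) * -1ℤ        ≡⟨ collect (ψ 1#) (+ length N) ⟩
    ψ 1# * (+ 1 + + length N) + + 1               ≡⟨ cong (λ n → ψ 1# * + n + + 1) (sym order≡1+∣nonzero∣) ⟩
    ψ 1# * + order F + + 1                        ∎
    where
      N′ = N without 1#
      1∈N : 1# ∈ N
      1∈N = ∈-nonzero⁺ (0≢1 ∘ sym)
      ψ-sum[1+1⁻¹] : ψ-sum (1# +ꟳ 1# ⁻¹) ≡ + length N
      ψ-sum[1+1⁻¹] = trans (cong (λ x → ψ-sum (1# +ꟳ x)) 1⁻¹≡1) (trans (cong ψ-sum (x+x≡0 1#)) ψ-sum-0)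
      ψ-sum[1+α⁻¹] : ∀ {α} → α ∈ N′ → ψ α * ψ-sum (1# +ꟳ α ⁻¹) ≡ ψ α * -1ℤ
      ψ-sum[1+α⁻¹] α∈N′ with ∈-filter⁻ (λ x → ¬? (x ≟ 1#)) {xs = N} α∈N′
      ... | α∈N , α≢1 = cong (ψ _ *_) (ψ-sum-nonzero (1+x⁻¹≢0 (∈-nonzero⁻ α∈N) α≢1))
      ∑N′ψ : ∑ N′ ψ ≡ -1ℤ - ψ 1#
      ∑N′ψ = begin
        ∑ N′ ψ                ≡⟨ s≡a+s-a (ψ 1#) (∑ N′ ψ) ⟩
        ψ 1# + ∑ N′ ψ - ψ 1#  ≡⟨ cong (_- ψ 1#) (sym (∑-without _≟_ ψ nonzero-unique 1∈N)) ⟩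
        ∑ N ψ - ψ 1#          ≡⟨ cong (_- ψ 1#) ∑ψ-nonzero ⟩
        -1ℤ - ψ 1#            ∎
        where s≡a+s-a : ∀ a s → s ≡ a + s - a
              s≡a+s-a = solve-∀
      collect : ∀ s n → s * n + (-1ℤ - s) * -1ℤ ≡ s * (+ 1 + n) + + 1
      collect = solve-∀

  twice-indicator-0 : ∀ t i → + 2 * (if does (t ≟ 0#) then i else + 0) ≡ i + sign t * i
  -- The `with` also abstracts the test hidden in `sign t`, so both sides reduce.
  twice-indicator-0 t i with t ≟ 0#
  ... | yes _ = 2i≡i+1i i
    where 2i≡i+1i : ∀ i → + 2 * i ≡ i + + 1 * i
          2i≡i+1i = solve-∀
  ... | no _  = 0≡i-1i i
    where 0≡i-1i : ∀ i → + 0 ≡ i + -1ℤ * i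
          0≡i-1i = solve-∀

  twice-indicator-1 : ∀ {t} i → IsBit t → + 2 * (if does (t ≟ 1#) then i else + 0) ≡ i + -1ℤ * (sign t * i)
  twice-indicator-1 i (inj₁ refl) with 0# ≟ 1#
  ... | yes 0≡1 = contradiction 0≡1 0≢1
  ... | no _    = trans (0≡i-[1i] i) (cong (λ s → i + -1ℤ * (s * i)) (sym sign-0))
    where 0≡i-[1i] : ∀ i → + 0 ≡ i + -1ℤ * (+ 1 * i)
          0≡i-[1i] = solve-∀
  twice-indicator-1 i (inj₂ refl) with 1# ≟ 1#
  ... | no 1≢1 = contradiction refl 1≢1
  ... | yes _  = trans (2i≡i-[-1i] i) (cong (λ s → i + -1ℤ * (s * i)) (sym sign-1))
    where 2i≡i-[-1i] : ∀ i → + 2 * i ≡ i + -1ℤ * (-1ℤ * i)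
          2i≡i-[-1i] = solve-∀

  ∑-trace≡0 : ∀ xs (f : Carrier → ℤ) →
              + 2 * ∑ (filter (λ a → tr F r a ≟ 0#) xs) f ≡ ∑ xs f + ∑[ a ∈ xs ] (ψ a * f a)
  ∑-trace≡0 xs f = begin
    + 2 * ∑ (filter (λ a → tr F r a ≟ 0#) xs) f                      ≡⟨ cong (λ s → + 2 * s) (∑-filter _ xs f) ⟩
    + 2 * ∑[ a ∈ xs ] (if does (tr F r a ≟ 0#) then f a else + 0)    ≡⟨ sym (∑-*ˡ xs (+ 2) _) ⟩
    ∑[ a ∈ xs ] (+ 2 * (if does (tr F r a ≟ 0#) then f a else + 0))  ≡⟨ ∑-cong xs (λ {a} _ → twice-indicator-0 (tr F r a) (f a)) ⟩
    ∑[ a ∈ xs ] (f a + ψ a * f a)                                    ≡⟨ ∑-distrib xs f _ ⟩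
    ∑ xs f + ∑[ a ∈ xs ] (ψ a * f a)                                 ∎

  ∑-trace≡1 : ∀ xs (f : Carrier → ℤ) →
              + 2 * ∑ (filter (λ a → tr F r a ≟ 1#) xs) f ≡ ∑ xs f + -1ℤ * ∑[ a ∈ xs ] (ψ a * f a)
  ∑-trace≡1 xs f = begin
    + 2 * ∑ (filter (λ a → tr F r a ≟ 1#) xs) f                      ≡⟨ cong (λ s → + 2 * s) (∑-filter _ xs f) ⟩
    + 2 * ∑[ a ∈ xs ] (if does (tr F r a ≟ 1#) then f a else + 0)    ≡⟨ sym (∑-*ˡ xs (+ 2) _) ⟩
    ∑[ a ∈ xs ] (+ 2 * (if does (tr F r a ≟ 1#) then f a else + 0))  ≡⟨ ∑-cong xs (λ {a} _ → twice-indicator-1 (f a) (trace-bit a)) ⟩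
    ∑[ a ∈ xs ] (f a + -1ℤ * (ψ a * f a))                            ≡⟨ ∑-distrib xs f _ ⟩
    ∑ xs f + ∑[ a ∈ xs ] (-1ℤ * (ψ a * f a))                         ≡⟨ cong (λ s → ∑ xs f + s) (∑-*ˡ xs -1ℤ _) ⟩
    ∑ xs f + -1ℤ * ∑[ a ∈ xs ] (ψ a * f a)                           ∎
    where trace-bit = traceSum-bit-order {r} order≡2^[1+k]

  twice-T₀K : + 2 * T₀K F r ≡ + 2 + -1ℤ ^ r * + (2 ℕ.^ r)
  twice-T₀K = begin
    + 2 * T₀K F r                             ≡⟨ ∑-trace≡0 N (K F r) ⟩
    ∑ N (K F r) + ∑[ a ∈ N ] (ψ a * K F r a)  ≡⟨ cong₂ _+_ ∑K ∑ψK ⟩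
    + 1 + (ψ 1# * + order F + + 1)            ≡⟨ rearrange (ψ 1# * + order F) ⟩
    + 2 + ψ 1# * + order F                    ≡⟨ cong₂ (λ s q → + 2 + s * + q) (sign-traceSum-1 r) order≡2^[1+k] ⟩
    + 2 + -1ℤ ^ r * + (2 ℕ.^ r)               ∎
    where rearrange : ∀ x → + 1 + (x + + 1) ≡ + 2 + x
          rearrange = solve-∀

  twice-T₁K : + 2 * T₁K F r ≡ -1ℤ ^ suc r * + (2 ℕ.^ r)
  twice-T₁K = begin
    + 2 * T₁K F r                                   ≡⟨ ∑-trace≡1 N (K F r) ⟩
    ∑ N (K F r) + -1ℤ * ∑[ a ∈ N ] (ψ a * K F r a)  ≡⟨ cong₂ (λ s t → s + -1ℤ * t) ∑K ∑ψK ⟩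
    + 1 + -1ℤ * (ψ 1# * + order F + + 1)            ≡⟨ rearrange (ψ 1#) (+ order F) ⟩
    -1ℤ * ψ 1# * + order F                          ≡⟨ cong₂ (λ s q → -1ℤ * s * + q) (sign-traceSum-1 r) order≡2^[1+k] ⟩
    -1ℤ ^ suc r * + (2 ℕ.^ r)                       ∎
    where rearrange : ∀ x q → + 1 + -1ℤ * (x * q + + 1) ≡ -1ℤ * x * q
          rearrange = solve-∀

open import Data.Nat using (ℕ; suc; _≥_; _^_)
open import Data.Integer using (ℤ; +_; -_; _+_; _*_) renaming (_^_ to _^ℤ_)
open import Data.Product using (_×_)

proposition8 : (r : ℕ) → r ≥ 1 → (F : FiniteField) → order F ≡ 2 ^ r →
    ((+ 2) * T₀K F r ≡ (+ 2) + (- (+ 1)) ^ℤ r * (+ (2 ^ r)))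
    × ((+ 2) * T₁K F r ≡ (- (+ 1)) ^ℤ (suc r) * (+ (2 ^ r)))
proposition8 zero    ()
proposition8 (suc k) _  F order≡2^r = twice-T₀K , twice-T₁K
  where open KloostermanSums F k order≡2^r
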